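{- Let $T$ be a tree on at least three vertices and let $S\subseteq V(T)$. Then $S$ is a minimal fort of $T$ if and only if both of the following hold: (I) $S$ contains at least one leaf of $T$; and (II) for every leaf $\ell\in S$, every edge $\{a,b\}$ of $T$ such that $a$ is closer to $\ell$ than $b$ (possibly $a=\ell$, or $b$ a leaf) satisfies: (i) if $a,b\notin S$, then $N(b)\cap S=\emptyset$; (ii) if $a\notin S$ and $b\in S$, then $|N(b)\cap S|\le 1$; (iii) if $a\in S$ and $b\notin S$, then $|(N(b)\cap S)\setminus\{a\}| = 1$; (iv) if $a,b\in S$, then $|(N(b)\cap S)\setminus\{a\}| = 0$.
   Context: $N(b)$ denotes the set of neighbors of $b$. A leaf is a vertex of degree one. Distances are graph distances in $T$. A fort of a graph is a nonempty set $F$ of vertices such that every vertex not in $F$ is adjacent to either zero or at least two vertices of $F$; it is minimal if no proper subset is a fort. -}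

module Defs where

open import Data.Nat using (ℕ; zero; suc; _≤_; _<_; _+_)
open import Data.Bool using (Bool; true; false)
open import Data.Fin using (Fin)
open import Data.Fin.Subset using (Subset; _∈_; _∉_; _⊂_; _∩_; _-_; ∣_∣; Nonempty)
open import Data.Vec using (tabulate)
open import Data.List using (List; []; _∷_; length; head; last)
open import Data.List.Relation.Unary.Unique.Propositional using (Unique)
open import Data.List.Relation.Unary.Linked using (Linked)
open import Data.Maybe using (Maybe; just; nothing)
open import Data.Product using (Σ; ∃; _×_)
open import Relation.Binary.PropositionalEquality using (_≡_; _≢_)
open import Relation.Nullary using (¬_)

record Graph (n : ℕ) : Set where
  field
    adj       : Fin n → Fin n → Bool
    symmetric : ∀ u v → adj u v ≡ adj v u
    irrefl    : ∀ v → adj v v ≡ false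

module _ {n : ℕ} (G : Graph n) where
  open Graph G

  Adj : Fin n → Fin n → Set
  Adj u v = adj u v ≡ true

  N : Fin n → Subset n
  N v = tabulate (adj v)

  degree : Fin n → ℕ
  degree v = ∣ N v ∣

  IsLeaf : Fin n → Set
  IsLeaf v = degree v ≡ 1

  data Walk : Fin n → Fin n → ℕ → Set where
    here : ∀ {u} → Walk u u 0
    step : ∀ {u v w k} → Adj u v → Walk v w k → Walk u w (suc k)

  Connected : Set
  Connected = ∀ u v → ∃ λ k → Walk u v k

  record Cycle : Set where
    field
      verts    : List (Fin n)
      long     : 3 ≤ length verts
      distinct : Unique verts
      linked   : Linked Adj verts
      closing  : ∀ x y → head verts ≡ just x → last verts ≡ just y → Adj y x

  Acyclic : Set
  Acyclic = ¬ Cycle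

  IsTree : Set
  IsTree = Connected × Acyclic

  Dist : Fin n → Fin n → ℕ → Set
  Dist u v d = Walk u v d × (∀ k → Walk u v k → d ≤ k)

  Closer : Fin n → Fin n → Fin n → Set
  Closer ℓ a b = ∃ λ da → ∃ λ db → Dist ℓ a da × Dist ℓ b db × da < db

  IsFort : Subset n → Set
  IsFort F = Nonempty F × (∀ v → v ∉ F → ∣ N v ∩ F ∣ ≢ 1)

  IsMinimalFort : Subset n → Set
  IsMinimalFort F = IsFort F × (∀ F′ → F′ ⊂ F → ¬ IsFort F′)

  EdgeCondition : Subset n → Fin n → Fin n → Set
  EdgeCondition S a b =
      (a ∉ S → b ∉ S → ∣ N b ∩ S ∣ ≡ 0)
    × (a ∉ S → b ∈ S → ∣ N b ∩ S ∣ ≤ 1)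
    × (a ∈ S → b ∉ S → ∣ (N b ∩ S) - a ∣ ≡ 1)
    × (a ∈ S → b ∈ S → ∣ (N b ∩ S) - a ∣ ≡ 0)

  ConditionI : Subset n → Set
  ConditionI S = ∃ λ ℓ → IsLeaf ℓ × ℓ ∈ S

  ConditionII : Subset n → Set
  ConditionII S = ∀ ℓ → IsLeaf ℓ → ℓ ∈ S →
    ∀ a b → Adj a b → Closer ℓ a b → EdgeCondition S a b

{-# OPTIONS --safe #-}

-- Root the tree at a vertex of S and orient every edge from parent to child.
--
-- A minimal fort S cannot be cut: if no edge joins X ∖ S to S ∖ X and no vertex
-- outside X has exactly one neighbour in S ∩ X, then S ∩ X is a fort, so it is
-- empty or all of S. Choosing X as a subtree's complement (case i), the union of
-- two sibling subtrees (cases ii, iii), or a subtree's complement plus one child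
-- subtree (case iv) rules out every configuration forbidden by (II); and a deepest
-- vertex of S is a leaf, since a child of it would have exactly one neighbour in S.
--
-- Conversely, root T at a leaf ℓ ∈ S given by (I); condition (II) makes S a fort.
-- Let z ∈ S ∖ {ℓ} with parent p. If p ∈ S, then z and p are each other's only
-- neighbours in S; otherwise the grandparent q lies in S and the only neighbours
-- of p in S are z and q. Either way the fort condition forces every fort F ⊆ S to
-- contain z iff it contains p (resp. q), which is shallower. By induction on depth
-- every such F contains all of S or none of it.
module Submission where

open import Defs
open import Data.Bool using (Bool; true)
open import Data.Empty using (⊥; ⊥-elim)
open import Data.Fin using (Fin; zero; suc; punchIn; _≟_)
open import Data.Fin.Properties using (any?; punchInᵢ≢i)
open import Data.Fin.Subset
  using (Subset; _∈_; _∉_; _⊆_; _∩_; _∪_; ∁; _-_; ⁅_⁆; ∣_∣; Nonempty)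
open import Data.Fin.Subset.Properties
  using ( _∈?_; nonempty?; ⊆-antisym; Empty-unique; ∣⊥∣≡0; x∈⁅x⁆; x∈⁅y⁆⇒x≡y; ∣⁅x⁆∣≡1
        ; p⊆q⇒∣p∣≤∣q∣; x∈p∩q⁺; x∈p∩q⁻; x∈p∪q⁺; x∈p∪q⁻
        ; x∈p⇒x∉∁p; x∈∁p⇒x∉p; x∉p⇒x∈∁p; x∉∁p⇒x∈p
        ; p─q⊆p; x∈p∧x≢y⇒x∈p-y; x∈p⇒∣p-x∣<∣p∣ )
open import Data.List using (List; []; _∷_; _∷ʳ_; length; last; filter; allFin)
import Data.List.Membership.Propositional.Properties as List
open import Data.List.Relation.Unary.All as All using (All; []; _∷_)
import Data.List.Relation.Unary.All.Properties as All
open import Data.List.Relation.Unary.AllPairs using ([]; _∷_)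
open import Data.List.Relation.Unary.Any using (here)
open import Data.List.Relation.Unary.Linked using (Linked; [-]; _∷_)
import Data.List.Relation.Unary.Linked.Properties as Linked
open import Data.List.Relation.Unary.Unique.Propositional using (Unique)
import Data.List.Relation.Unary.Unique.Propositional.Properties as Unique
open import Data.List.Extrema.Nat using (argmax; argmax-all; f[xs]≤f[argmax])
open import Data.Maybe using (just)
open import Data.Maybe.Properties using (just-injective)
open import Data.Maybe.Relation.Binary.Connected as Maybe using (just)
open import Data.Nat using (ℕ; zero; suc; _≤_; _<_; _∸_; z≤n; s≤s; _≤?_)
open import Data.Nat.GeneralisedArithmetic using (iterate)
open import Data.Nat.Induction using (<-wellFounded)
open import Data.Nat.Properties hiding (_≟_)
open import Data.Product using (∃; ∃-syntax; _×_; _,_; proj₁; proj₂)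
open import Data.Sum using (_⊎_; inj₁; inj₂; swap)
open import Data.Vec using (tabulate; _∷_)
open import Data.Vec.Base using (there)
open import Data.Vec.Properties using (lookup∘tabulate; lookup⇒[]=; []=⇒lookup)
open import Function using (_∘_; _⇔_; mk⇔; Equivalence)
open import Function.Construct.Composition using (_⇔-∘_)
open import Function.Construct.Identity using (⇔-id)
open import Induction.WellFounded using (Acc; acc)
open import Relation.Binary.PropositionalEquality
open import Relation.Nullary using (¬_; Dec; yes; no; contradiction)
open import Relation.Nullary.Decidable using (isYes; _×-dec_)
open import Relation.Unary using (Decidable)

private
  variable
    n k : ℕ

least : ∀ {P : ℕ → Set} → (∀ k → Dec (P k)) → P k → ∃[ d ] (P d × (∀ j → P j → d ≤ j))
least {k = k} {P = P} P? pk = go k (<-wellFounded k) pk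
  where
  go : ∀ k → Acc _<_ k → P k → ∃[ d ] (P d × (∀ j → P j → d ≤ j))
  go k (acc smaller) pk with anyUpTo? P? k
  ... | yes (j , j<k , pj) = go j (smaller j<k) pj
  ... | no ∄j<k = k , pk , λ j pj → ≮⇒≥ (λ j<k → ∄j<k (j , j<k , pj))

last-∷ʳ : ∀ {A : Set} (xs : List A) (y : A) → last (xs ∷ʳ y) ≡ just y
last-∷ʳ []           y = refl
last-∷ʳ (_ ∷ [])     y = refl
last-∷ʳ (_ ∷ _ ∷ xs) y = last-∷ʳ (_ ∷ xs) y

another-element : 2 ≤ n → (i : Fin n) → ∃[ j ] j ≢ i
another-element (s≤s (s≤s _)) i = punchIn i zero , punchInᵢ≢i i zero

x∉p-x : ∀ (p : Subset n) x → x ∉ p - x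
x∉p-x (_ ∷ p) zero    ()
x∉p-x (_ ∷ p) (suc x) (there x∈p-x) = x∉p-x p x x∈p-x

module _ {n : ℕ} where

  private
    variable
      x y : Fin n
      p : Subset n

  ∈tabulate⇔ : ∀ {f : Fin n → Bool} → x ∈ tabulate f ⇔ f x ≡ true
  ∈tabulate⇔ {x = x} {f = f} = mk⇔
    (λ x∈ → trans (sym (lookup∘tabulate f x)) ([]=⇒lookup x∈))
    (λ fx → lookup⇒[]= x (tabulate f) (trans (lookup∘tabulate f x) fx))

  ⟦_⟧ : ∀ {P : Fin n → Set} → Decidable P → Subset n
  ⟦ P? ⟧ = tabulate (isYes ∘ P?)

  ∈⟦⟧⇔ : ∀ {P : Fin n → Set} {P? : Decidable P} → x ∈ ⟦ P? ⟧ ⇔ P x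
  ∈⟦⟧⇔ {x = x} {P? = P?} =
    mk⇔ (to (P? x) ∘ Equivalence.to ∈tabulate⇔) (Equivalence.from ∈tabulate⇔ ∘ from (P? x))
    where
    to : ∀ {A : Set} (a? : Dec A) → isYes a? ≡ true → A
    to (yes a) _ = a
    from : ∀ {A : Set} (a? : Dec A) → A → isYes a? ≡ true
    from (yes _) _ = refl
    from (no ¬a) a = contradiction a ¬a

  x∈p-y⁻ : ∀ p → x ∈ p - y → x ∈ p × x ≢ y
  x∈p-y⁻ {y = y} p x∈p-y = p─q⊆p p ⁅ y ⁆ x∈p-y , λ { refl → x∉p-x p _ x∈p-y }

  x∈p⇒1≤∣p∣ : x ∈ p → 1 ≤ ∣ p ∣
  x∈p⇒1≤∣p∣ {x = x} {p = p} x∈p =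
    subst (_≤ ∣ p ∣) (∣⁅x⁆∣≡1 x) (p⊆q⇒∣p∣≤∣q∣ λ y∈⁅x⁆ → subst (_∈ p) (sym (x∈⁅y⁆⇒x≡y x y∈⁅x⁆)) x∈p)

  ∣p∣≡0⇒x∉p : ∣ p ∣ ≡ 0 → x ∉ p
  ∣p∣≡0⇒x∉p ∣p∣≡0 x∈p = m<n⇒n≢0 (x∈p⇒1≤∣p∣ x∈p) ∣p∣≡0

  x∉p⇒∣p∣≡0 : ∀ {p : Subset n} → (∀ x → x ∉ p) → ∣ p ∣ ≡ 0
  x∉p⇒∣p∣≡0 x∉p = trans (cong ∣_∣ (Empty-unique λ (x , x∈p) → x∉p x x∈p)) (∣⊥∣≡0 n)

  ≡⇒∣p∣≤1 : (∀ {x y} → x ∈ p → y ∈ p → x ≡ y) → ∣ p ∣ ≤ 1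
  ≡⇒∣p∣≤1 {p = p} all≡ with nonempty? p
  ... | yes (x , x∈p) = subst (∣ p ∣ ≤_) (∣⁅x⁆∣≡1 x)
                          (p⊆q⇒∣p∣≤∣q∣ λ y∈p → subst (_∈ ⁅ x ⁆) (all≡ x∈p y∈p) (x∈⁅x⁆ x))
  ... | no ∄x = ≤-trans (≤-reflexive (x∉p⇒∣p∣≡0 λ x x∈p → ∄x (x , x∈p))) z≤n

  ∣p∣≤1⇒≡ : ∣ p ∣ ≤ 1 → x ∈ p → y ∈ p → x ≡ y
  ∣p∣≤1⇒≡ {x = x} {y = y} ∣p∣≤1 x∈p y∈p with x ≟ y
  ... | yes x≡y = x≡y
  ... | no x≢y = contradiction ∣p∣≤1 (<⇒≱ (≤-trans (s≤s (x∈p⇒1≤∣p∣ y∈p-x)) (x∈p⇒∣p-x∣<∣p∣ x∈p)))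
    where y∈p-x = x∈p∧x≢y⇒x∈p-y y∈p (x≢y ∘ sym)

  ∣p-x∣≡0⇒≡ : ∣ p - x ∣ ≡ 0 → y ∈ p → y ≡ x
  ∣p-x∣≡0⇒≡ {x = x} {y = y} ∣p-x∣≡0 y∈p with y ≟ x
  ... | yes y≡x = y≡x
  ... | no y≢x = contradiction (x∈p∧x≢y⇒x∈p-y y∈p y≢x) (∣p∣≡0⇒x∉p ∣p-x∣≡0)

  ∣p∣≡1 : x ∈ p → (∀ {y} → y ∈ p → y ≡ x) → ∣ p ∣ ≡ 1
  ∣p∣≡1 x∈p only = ≤-antisym (≡⇒∣p∣≤1 λ y∈p z∈p → trans (only y∈p) (sym (only z∈p))) (x∈p⇒1≤∣p∣ x∈p)

  ∣p∣≢1⇒another : x ∈ p → ∣ p ∣ ≢ 1 → ∃[ y ] (y ∈ p × y ≢ x)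
  ∣p∣≢1⇒another {x = x} {p = p} x∈p ∣p∣≢1 with nonempty? (p - x)
  ... | yes (y , y∈p-x) = y , x∈p-y⁻ p y∈p-x
  ... | no ∄y = contradiction (∣p∣≡1 x∈p only-x) ∣p∣≢1
    where
    only-x : ∀ {y} → y ∈ p → y ≡ x
    only-x {y} y∈p with y ≟ x
    ... | yes y≡x = y≡x
    ... | no y≢x = contradiction (y , x∈p∧x≢y⇒x∈p-y y∈p y≢x) ∄y

  two⇒∣p∣≢1 : x ∈ p → y ∈ p → x ≢ y → ∣ p ∣ ≢ 1
  two⇒∣p∣≢1 x∈p y∈p x≢y ∣p∣≡1 = x≢y (∣p∣≤1⇒≡ (≤-reflexive ∣p∣≡1) x∈p y∈p)

  ∣p-x∣≡1⇒∣p∣≢1 : x ∈ p → ∣ p - x ∣ ≡ 1 → ∣ p ∣ ≢ 1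
  ∣p-x∣≡1⇒∣p∣≢1 x∈p ∣p-x∣≡1 ∣p∣≡1 = <-irrefl refl (subst₂ _<_ ∣p-x∣≡1 ∣p∣≡1 (x∈p⇒∣p-x∣<∣p∣ x∈p))

module _ {n} (G : Graph n) where

  private
    variable
      u v w y z : Fin n
      F S X : Subset n

  Adj-sym : Adj G u v → Adj G v u
  Adj-sym {u} {v} u~v = trans (Graph.symmetric G v u) u~v

  Adj⇒≢ : Adj G u v → u ≢ v
  Adj⇒≢ {u} u~u refl with () ← trans (sym u~u) (Graph.irrefl G u)

  ∈N⁺ : Adj G v y → y ∈ N G v
  ∈N⁺ = Equivalence.from ∈tabulate⇔

  ∈N∩⁺ : Adj G v y → y ∈ F → y ∈ N G v ∩ F
  ∈N∩⁺ v~y y∈F = x∈p∩q⁺ (∈N⁺ v~y , y∈F)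

  ∈N⁻ : y ∈ N G v → Adj G v y
  ∈N⁻ = Equivalence.to ∈tabulate⇔

  ∈N∩⁻ : y ∈ N G v ∩ F → Adj G v y × y ∈ F
  ∈N∩⁻ {F = F} y∈ with x∈p∩q⁻ _ F y∈
  ... | y∈N , y∈F = ∈N⁻ y∈N , y∈F

  no-neighbour⇒∣N∩∣≡0 : (∀ {y} → Adj G v y → y ∉ F) → ∣ N G v ∩ F ∣ ≡ 0
  no-neighbour⇒∣N∩∣≡0 y∉F = x∉p⇒∣p∣≡0 λ _ y∈ → y∉F (proj₁ (∈N∩⁻ y∈)) (proj₂ (∈N∩⁻ y∈))

  no-neighbour⇒∣N∩∣≢1 : (∀ {y} → Adj G v y → y ∉ F) → ∣ N G v ∩ F ∣ ≢ 1
  no-neighbour⇒∣N∩∣≢1 y∉F ∣∣≡1 = 0≢1+n (trans (sym (no-neighbour⇒∣N∩∣≡0 y∉F)) ∣∣≡1)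

  two-neighbours⇒∣N∩∣≢1 : Adj G v y → y ∈ F → Adj G v z → z ∈ F → y ≢ z → ∣ N G v ∩ F ∣ ≢ 1
  two-neighbours⇒∣N∩∣≢1 v~y y∈F v~z z∈F = two⇒∣p∣≢1 (∈N∩⁺ v~y y∈F) (∈N∩⁺ v~z z∈F)

  walk? : ∀ u v k → Dec (Walk G u v k)
  walk? u v zero with u ≟ v
  ... | yes refl = yes here
  ... | no u≢v = no λ { here → u≢v refl }
  walk? u v (suc k) with any? (λ w → (Graph.adj G u w Data.Bool.≟ true) ×-dec walk? w v k)
  ... | yes (w , u~w , walk) = yes (step u~w walk)
  ... | no ∄w = no λ { (step u~w walk) → ∄w (_ , u~w , walk) }

  Walk₀⇒≡ : Walk G u v 0 → u ≡ v
  Walk₀⇒≡ here = refl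

  walk-∷ʳ : Walk G u v k → Adj G v w → Walk G u w (suc k)
  walk-∷ʳ here         v~w = step v~w here
  walk-∷ʳ (step u~ walk) v~w = step u~ (walk-∷ʳ walk v~w)

  walk-unsnoc : Walk G u w (suc k) → ∃[ v ] (Walk G u v k × Adj G v w)
  walk-unsnoc (step u~w here)              = _ , here , u~w
  walk-unsnoc (step u~ walk@(step _ _)) with walk-unsnoc walk
  ... | v , walk′ , v~w = v , step u~ walk′ , v~w

  fort-second-neighbour : IsFort G F → v ∉ F → Adj G v y → y ∈ F →
                          ∃[ z ] (Adj G v z × z ∈ F × z ≢ y)
  fort-second-neighbour (_ , fortF) v∉F v~y y∈F
    with z , z∈ , z≢y ← ∣p∣≢1⇒another (∈N∩⁺ v~y y∈F) (fortF _ v∉F)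
    = z , proj₁ (∈N∩⁻ z∈) , proj₂ (∈N∩⁻ z∈) , z≢y

  fort-absorbs : IsFort G F → F ⊆ S → Adj G v y → y ∈ F →
                 (∀ {z} → Adj G v z → z ∈ S → z ≡ y) → v ∈ F
  fort-absorbs {F = F} {v = v} fortF F⊆S v~y y∈F only-y with v ∈? F
  ... | yes v∈F = v∈F
  ... | no v∉F with z , v~z , z∈F , z≢y ← fort-second-neighbour fortF v∉F v~y y∈F
    = contradiction (only-y v~z (F⊆S z∈F)) z≢y

  fort-propagates : IsFort G F → F ⊆ S → v ∉ S → Adj G v y →
                    (∀ {z} → Adj G v z → z ∈ S → z ≡ y ⊎ z ≡ w) → y ∈ F → w ∈ F
  fort-propagates {F = F} fortF F⊆S v∉S v~y y-or-w y∈F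
    with z , v~z , z∈F , z≢y ← fort-second-neighbour fortF (v∉S ∘ F⊆S) v~y y∈F
    with y-or-w v~z (F⊆S z∈F)
  ... | inj₁ z≡y = contradiction z≡y z≢y
  ... | inj₂ z≡w = subst (_∈ F) z≡w z∈F

  ∩-isFort : IsFort G S → Nonempty (S ∩ X) →
             (∀ {u w} → Adj G u w → u ∈ X → u ∉ S → w ∈ S → w ∉ X → ⊥) →
             (∀ w → w ∉ X → ∣ N G w ∩ (S ∩ X) ∣ ≢ 1) →
             IsFort G (S ∩ X)
  ∩-isFort {S = S} {X = X} (_ , fortS) nonempty sealed outside = nonempty , fort
    where
    fort : ∀ v → v ∉ S ∩ X → ∣ N G v ∩ (S ∩ X) ∣ ≢ 1
    fort v v∉S∩X with v ∈? X
    ... | no v∉X = outside v v∉X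
    ... | yes v∈X = subst (_≢ 1) (cong ∣_∣ (⊆-antisym inX fromX)) (fortS v v∉S)
      where
      v∉S : v ∉ S
      v∉S v∈S = v∉S∩X (x∈p∩q⁺ (v∈S , v∈X))
      inX : N G v ∩ S ⊆ N G v ∩ (S ∩ X)
      inX {y} y∈ with v~y , y∈S ← ∈N∩⁻ y∈ with y ∈? X
      ... | yes y∈X = ∈N∩⁺ v~y (x∈p∩q⁺ (y∈S , y∈X))
      ... | no y∉X = ⊥-elim (sealed v~y v∈X v∉S y∈S y∉X)
      fromX : N G v ∩ (S ∩ X) ⊆ N G v ∩ S
      fromX y∈ with v~y , y∈S∩X ← ∈N∩⁻ y∈ = ∈N∩⁺ v~y (proj₁ (x∈p∩q⁻ S X y∈S∩X))

  minimal-fort-uncuttable : IsMinimalFort G S → y ∈ S → y ∈ X → z ∈ S → z ∉ X →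
                            (∀ {u w} → Adj G u w → u ∈ X → u ∉ S → w ∈ S → w ∉ X → ⊥) →
                            (∀ w → w ∉ X → ∣ N G w ∩ (S ∩ X) ∣ ≢ 1) → ⊥
  minimal-fort-uncuttable {S = S} {X = X} (fortS , minS) y∈S y∈X z∈S z∉X sealed outside =
    minS (S ∩ X) (proj₁ ∘ x∈p∩q⁻ S X , _ , z∈S , z∉X ∘ proj₂ ∘ x∈p∩q⁻ S X)
         (∩-isFort fortS (_ , x∈p∩q⁺ (y∈S , y∈X)) sealed outside)

module Rooted {n} (T : Graph n) (connected : Connected T) (acyclic : Acyclic T) (r : Fin n) where

  private
    variable
      a b c u v w x y z : Fin n
      d : ℕ

  distance : ∀ v → ∃ (Dist T r v)
  distance v with _ , walk ← connected r v = least (walk? T r v) walk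

  depth : Fin n → ℕ
  depth v = proj₁ (distance v)

  depth-walk : ∀ v → Walk T r v (depth v)
  depth-walk v = proj₁ (proj₂ (distance v))

  depth-minimal : Walk T r v k → depth v ≤ k
  depth-minimal {v = v} walk = proj₂ (proj₂ (distance v)) _ walk

  Dist⇒≡depth : Dist T r v d → d ≡ depth v
  Dist⇒≡depth (walk , minimal) = ≤-antisym (minimal _ (depth-walk _)) (depth-minimal walk)

  depth-r : depth r ≡ 0
  depth-r = n≤0⇒n≡0 (depth-minimal here)

  depth≡0⇒≡r : depth v ≡ 0 → v ≡ r
  depth≡0⇒≡r {v} dv≡0 = sym (Walk₀⇒≡ T (subst (Walk T r v) dv≡0 (depth-walk v)))

  depth≡suc⇒≢r : depth v ≡ suc d → v ≢ r
  depth≡suc⇒≢r dv refl = 0≢1+n (trans (sym depth-r) dv)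

  depth-step : Adj T u v → depth v ≤ suc (depth u)
  depth-step u~v = depth-minimal (walk-∷ʳ T (depth-walk _) u~v)

  parent-exists : v ≢ r → ∃[ p ] (Adj T p v × depth v ≡ suc (depth p))
  parent-exists v≢r = last-edge v≢r (proj₂ (distance _))
    where
    last-edge : ∀ {v d} → v ≢ r → Dist T r v d → ∃[ p ] (Adj T p v × d ≡ suc (depth p))
    last-edge r≢r (here , _) = contradiction refl r≢r
    last-edge {d = suc d} _ (walk , minimal) with p , walk′ , p~v ← walk-unsnoc T walk =
      p , p~v , cong suc (≤-antisym (≤-pred (minimal _ (walk-∷ʳ T (depth-walk p) p~v)))
                                    (depth-minimal walk′))

  -- The root is its own parent, a junk value: Parent below excludes the root as a child.
  parent : Fin n → Fin n
  parent v with v ≟ r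
  ... | yes _   = r
  ... | no v≢r = proj₁ (parent-exists v≢r)

  parent-spec : v ≢ r → Adj T (parent v) v × depth v ≡ suc (depth (parent v))
  parent-spec {v} v≢r with v ≟ r
  ... | yes v≡r = contradiction v≡r v≢r
  ... | no _    = proj₂ (parent-exists _)

  Parent : Fin n → Fin n → Set
  Parent a b = b ≢ r × parent b ≡ a

  Parent⇒Adj : Parent a b → Adj T a b
  Parent⇒Adj (b≢r , refl) = proj₁ (parent-spec b≢r)

  Parent⇒depth : Parent a b → depth b ≡ suc (depth a)
  Parent⇒depth (b≢r , refl) = proj₂ (parent-spec b≢r)

  Parent-unique : Parent a c → Parent b c → a ≡ b
  Parent-unique (_ , refl) (_ , refl) = refl

  Parent⇒depth< : Parent a b → depth a < depth b
  Parent⇒depth< a⇝b = ≤-reflexive (sym (Parent⇒depth a⇝b))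

  Parent-asym : Parent a b → Parent b a → ⊥
  Parent-asym a⇝b b⇝a = <-asym (Parent⇒depth< a⇝b) (Parent⇒depth< b⇝a)

  record LowPath (d : ℕ) (x y : Fin n) : Set where
    field
      rest   : List (Fin n)
      unique : Unique (x ∷ rest)
      linked : Linked (Adj T) (x ∷ rest)
      ends   : last (x ∷ rest) ≡ just y
      low    : All (λ z → depth z ≤ d) (x ∷ rest)
      long   : x ≢ y → 3 ≤ length (x ∷ rest)

  deeper-∉ : ∀ {zs} → depth z ≡ suc d → All (λ w → depth w ≤ d) zs → All (z ≢_) zs
  deeper-∉ {d = d} dz = All.map λ w≤d z≡w → 1+n≰n (subst (_≤ d) (trans (cong depth (sym z≡w)) dz) w≤d)

  -- Climb from x and y in parallel until the two climbs meet.
  low-path : depth x ≡ d → depth y ≡ d → LowPath d x y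
  low-path {x} {d} {y} dx dy with x ≟ y
  ... | yes refl = record
    { rest = [] ; unique = [] ∷ [] ; linked = [-] ; ends = refl
    ; low = ≤-reflexive dx ∷ [] ; long = λ x≢x → contradiction refl x≢x }
  low-path {x} {zero} {y} dx dy | no x≢y =
    contradiction (trans (depth≡0⇒≡r dx) (sym (depth≡0⇒≡r dy))) x≢y
  low-path {x} {suc d} {y} dx dy | no x≢y = record
    { rest   = parent x ∷ P.rest ∷ʳ y
    ; unique = All.∷ʳ⁺ (deeper-∉ dx P.low) x≢y
             ∷ Unique.++⁺ P.unique ([] ∷ []) λ { (y∈ , here refl) → All.lookup (deeper-∉ dy P.low) y∈ refl }
    ; linked = Adj-sym T (proj₁ x-spec)
             ∷ Linked.++⁺ P.linked
                 (subst (λ m → Maybe.Connected (Adj T) m (just y)) (sym P.ends) (just (proj₁ y-spec))) [-]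
    ; ends   = last-∷ʳ (x ∷ parent x ∷ P.rest) y
    ; low    = ≤-reflexive dx ∷ All.∷ʳ⁺ (All.map m≤n⇒m≤1+n P.low) (≤-reflexive dy)
    ; long   = λ _ → s≤s (s≤s (length-∷ʳ-pos P.rest))
    }
    where
    x-spec = parent-spec (depth≡suc⇒≢r dx)
    y-spec = parent-spec (depth≡suc⇒≢r dy)
    module P = LowPath (low-path (suc-injective (trans (sym (proj₂ x-spec)) dx))
                                 (suc-injective (trans (sym (proj₂ y-spec)) dy)))
    length-∷ʳ-pos : ∀ zs → 1 ≤ length (zs ∷ʳ y)
    length-∷ʳ-pos []      = s≤s z≤n
    length-∷ʳ-pos (_ ∷ _) = s≤s z≤n

  level-edge-free : Adj T x y → depth x ≢ depth y
  level-edge-free {x} {y} x~y dx≡dy = acyclic record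
    { verts = x ∷ rest ; long = long (Adj⇒≢ T x~y) ; distinct = unique ; linked = linked
    ; closing = λ { _ _ refl last≡y′ →
        subst (λ z → Adj T z x) (just-injective (trans (sym ends) last≡y′)) (Adj-sym T x~y) } }
    where open LowPath (low-path refl (sym dx≡dy))

  two-parents-free : x ≢ y → depth x ≡ depth y → Adj T x v → Adj T y v → depth v ≡ suc (depth x) → ⊥
  two-parents-free {x} {y} {v} x≢y dx≡dy x~v y~v dv = acyclic record
    { verts = v ∷ x ∷ rest ; long = m≤n⇒m≤1+n (long x≢y)
    ; distinct = deeper-∉ dv low ∷ unique ; linked = Adj-sym T x~v ∷ linked
    ; closing = λ { _ _ refl last≡y′ →
        subst (λ z → Adj T z v) (just-injective (trans (sym ends) last≡y′)) y~v } }
    where open LowPath (low-path refl (sym dx≡dy))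

  deeper-neighbour⇒Parent : Adj T u v → depth v ≡ suc (depth u) → Parent u v
  deeper-neighbour⇒Parent {u} {v} u~v dv with v≢r ← depth≡suc⇒≢r dv with parent v ≟ u
  ... | yes pv≡u = v≢r , pv≡u
  ... | no pv≢u  = ⊥-elim (two-parents-free pv≢u (suc-injective (trans (sym dpv) dv)) pv~v u~v dpv)
    where
    pv~v = proj₁ (parent-spec v≢r)
    dpv  = proj₂ (parent-spec v≢r)

  Adj⇒Parent : Adj T u v → Parent u v ⊎ Parent v u
  Adj⇒Parent u~v with m≤n⇒m<n∨m≡n (depth-step u~v) | m≤n⇒m<n∨m≡n (depth-step (Adj-sym T u~v))
  ... | inj₂ dv≡ | _        = inj₁ (deeper-neighbour⇒Parent u~v dv≡)
  ... | _        | inj₂ du≡ = inj₂ (deeper-neighbour⇒Parent (Adj-sym T u~v) du≡)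
  ... | inj₁ dv< | inj₁ du< = ⊥-elim (level-edge-free u~v (≤-antisym (≤-pred du<) (≤-pred dv<)))

  other-neighbour⇒Parent : Parent a b → Adj T b c → c ≢ a → Parent b c
  other-neighbour⇒Parent a⇝b b~c c≢a with Adj⇒Parent b~c
  ... | inj₁ b⇝c = b⇝c
  ... | inj₂ c⇝b = contradiction (Parent-unique c⇝b a⇝b) c≢a

  Closer⇒Parent : Adj T a b → Closer T r a b → Parent a b
  Closer⇒Parent a~b (_ , _ , dist-a , dist-b , da<db) with Adj⇒Parent a~b
  ... | inj₁ a⇝b = a⇝b
  ... | inj₂ b⇝a = ⊥-elim (<-asym (subst₂ _<_ (Dist⇒≡depth dist-a) (Dist⇒≡depth dist-b) da<db)
                          (subst (depth _ <_) (sym (Parent⇒depth b⇝a)) (n<1+n _)))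

  Parent⇒Closer : Parent a b → Closer T r a b
  Parent⇒Closer a⇝b = _ , _ , proj₂ (distance _) , proj₂ (distance _) , ≤-reflexive (sym (Parent⇒depth a⇝b))

  root-has-child : 2 ≤ n → ∃[ w ] Parent r w
  root-has-child 2≤n with w , w≢r ← another-element 2≤n r with connected r w
  ... | zero  , walk = contradiction (sym (Walk₀⇒≡ T walk)) w≢r
  ... | suc _ , step r~v _ with Adj⇒Parent r~v
  ...   | inj₁ r⇝v        = _ , r⇝v
  ...   | inj₂ (r≢r , _) = contradiction refl r≢r

  -- v lies in the subtree of b iff b is the ancestor of v at depth (depth b).
  subtree : Fin n → Subset n
  subtree b = ⟦ (λ v → iterate parent v (depth v ∸ depth b) ≟ b) ⟧

  ∈subtree⁺ : iterate parent v (depth v ∸ depth b) ≡ b → v ∈ subtree b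
  ∈subtree⁺ = Equivalence.from ∈⟦⟧⇔

  ∈subtree⁻ : v ∈ subtree b → iterate parent v (depth v ∸ depth b) ≡ b
  ∈subtree⁻ = Equivalence.to ∈⟦⟧⇔

  b∈subtree[b] : b ∈ subtree b
  b∈subtree[b] {b} = ∈subtree⁺ (cong (iterate parent b) (n∸n≡0 (depth b)))

  ∈subtree⇒depth≤ : v ∈ subtree b → depth b ≤ depth v
  ∈subtree⇒depth≤ {v} {b} v∈ with depth b ≤? depth v
  ... | yes db≤dv = db≤dv
  ... | no db≰dv  = contradiction (≤-reflexive (cong depth (sym v≡b))) db≰dv
    where
    v≡b : v ≡ b
    v≡b = trans (cong (iterate parent v) (sym (m≤n⇒m∸n≡0 (<⇒≤ (≰⇒> db≰dv))))) (∈subtree⁻ v∈)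

  Parent⇒∉subtree : Parent a b → a ∉ subtree b
  Parent⇒∉subtree a⇝b a∈ = 1+n≰n (subst (_≤ depth _) (Parent⇒depth a⇝b) (∈subtree⇒depth≤ a∈))

  r∉subtree : b ≢ r → r ∉ subtree b
  r∉subtree {b} b≢r r∈ = b≢r (depth≡0⇒≡r (n≤0⇒n≡0 (subst (depth b ≤_) depth-r (∈subtree⇒depth≤ r∈))))

  iterate-parent-step : v ≢ r → depth b ≤ depth (parent v) →
    iterate parent v (depth v ∸ depth b) ≡ iterate parent (parent v) (depth (parent v) ∸ depth b)
  iterate-parent-step {v} {b} v≢r db≤dpv =
    cong (iterate parent v) (trans (cong (_∸ depth b) (proj₂ (parent-spec v≢r))) (+-∸-assoc 1 db≤dpv))

  ∈subtree-parent⇒∈subtree : v ≢ r → parent v ∈ subtree b → v ∈ subtree b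
  ∈subtree-parent⇒∈subtree v≢r pv∈ =
    ∈subtree⁺ (trans (iterate-parent-step v≢r (∈subtree⇒depth≤ pv∈)) (∈subtree⁻ pv∈))

  Parent⇒∈subtree : Parent b c → c ∈ subtree b
  Parent⇒∈subtree (c≢r , refl) = ∈subtree-parent⇒∈subtree c≢r b∈subtree[b]

  ∈subtree⇒≡∨parent∈subtree : v ≢ r → v ∈ subtree b → v ≡ b ⊎ parent v ∈ subtree b
  ∈subtree⇒≡∨parent∈subtree {v} {b} v≢r v∈ with depth b ≤? depth (parent v)
  ... | yes db≤dpv = inj₂ (∈subtree⁺ (trans (sym (iterate-parent-step v≢r db≤dpv)) (∈subtree⁻ v∈)))
  ... | no db≰dpv  = inj₁ (trans (cong (iterate parent v) (sym (m≤n⇒m∸n≡0 dv≤db))) (∈subtree⁻ v∈))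
    where
    dv≤db : depth v ≤ depth b
    dv≤db = subst (_≤ depth b) (sym (proj₂ (parent-spec v≢r))) (≰⇒> db≰dpv)

  leave-subtree : Adj T u w → u ∈ subtree b → w ∉ subtree b → u ≡ b × Parent w b
  leave-subtree u~w u∈ w∉ with Adj⇒Parent u~w
  ... | inj₁ (w≢r , refl) = contradiction (∈subtree-parent⇒∈subtree w≢r u∈) w∉
  ... | inj₂ (u≢r , refl) with ∈subtree⇒≡∨parent∈subtree u≢r u∈
  ...   | inj₁ u≡b = u≡b , subst (Parent _) u≡b (u≢r , refl)
  ...   | inj₂ pu∈ = contradiction pu∈ w∉

  enter-subtree : Adj T w y → y ∈ subtree c → w ∉ subtree c → Parent w c
  enter-subtree w~y y∈ w∉ = proj₂ (leave-subtree (Adj-sym T w~y) y∈ w∉)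

module Sufficiency {n} (T : Graph n) (connected : Connected T) (acyclic : Acyclic T)
                   (S : Subset n) {ℓ : Fin n} (ℓ-leaf : IsLeaf T ℓ) (ℓ∈S : ℓ ∈ S)
                   (conditionII : ConditionII T S) where

  open Rooted T connected acyclic ℓ

  private
    variable
      p q y z : Fin n

  edge-condition : Parent p z → EdgeCondition T S p z
  edge-condition p⇝z = conditionII ℓ ℓ-leaf ℓ∈S _ _ (Parent⇒Adj p⇝z) (Parent⇒Closer p⇝z)

  ∉S⇒Parent : z ∉ S → Parent (parent z) z
  ∉S⇒Parent z∉S = (λ { refl → z∉S ℓ∈S }) , refl

  isFort : IsFort T S
  isFort = (ℓ , ℓ∈S) , fort
    where
    fort : ∀ z → z ∉ S → ∣ N T z ∩ S ∣ ≢ 1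
    fort z z∉S with (i , _ , iii , _) ← edge-condition (∉S⇒Parent z∉S) with parent z ∈? S
    ... | no  p∉S = λ ∣∣≡1 → 0≢1+n (trans (sym (i p∉S z∉S)) ∣∣≡1)
    ... | yes p∈S = ∣p-x∣≡1⇒∣p∣≢1 (∈N∩⁺ T (Adj-sym T (Parent⇒Adj (∉S⇒Parent z∉S))) p∈S) (iii p∈S z∉S)

  only-S-neighbour-of-child : Parent p z → p ∈ S → z ∈ S → Adj T z y → y ∈ S → y ≡ p
  only-S-neighbour-of-child p⇝z p∈S z∈S z~y y∈S with (_ , _ , _ , iv) ← edge-condition p⇝z =
    ∣p-x∣≡0⇒≡ (iv p∈S z∈S) (∈N∩⁺ T z~y y∈S)

  only-S-neighbour-of-parent : Parent p z → p ∈ S → z ∈ S → Adj T p y → y ∈ S → y ≡ z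
  only-S-neighbour-of-parent {p} {z} p⇝z p∈S z∈S p~y y∈S with p ≟ ℓ
  ... | yes refl = ∣p∣≤1⇒≡ (≤-reflexive ℓ-leaf) (∈N⁺ T p~y) (∈N⁺ T (Parent⇒Adj p⇝z))
  ... | no p≢ℓ with (_ , ii , _ , iv) ← edge-condition (p≢ℓ , refl) with parent p ∈? S
  ...   | no  q∉S = ∣p∣≤1⇒≡ (ii q∉S p∈S) (∈N∩⁺ T p~y y∈S) (∈N∩⁺ T (Parent⇒Adj p⇝z) z∈S)
  ...   | yes q∈S = ⊥-elim (Parent-asym p⇝z (subst (λ q → Parent q p) (sym z≡q) (p≢ℓ , refl)))
    where
    z≡q : z ≡ parent p
    z≡q = ∣p-x∣≡0⇒≡ (iv q∈S p∈S) (∈N∩⁺ T (Parent⇒Adj p⇝z) z∈S)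

  S-grandchild⇒S-grandparent : Parent q p → Parent p z → p ∉ S → z ∈ S → q ∈ S
  S-grandchild⇒S-grandparent {q} q⇝p p⇝z p∉S z∈S with q ∈? S
  ... | yes q∈S = q∈S
  ... | no  q∉S with (i , _ , _ , _) ← edge-condition q⇝p =
    contradiction (∈N∩⁺ T (Parent⇒Adj p⇝z) z∈S) (∣p∣≡0⇒x∉p (i q∉S p∉S))

  S-neighbours-of-non-member : Parent q p → Parent p z → p ∉ S → z ∈ S → Adj T p y → y ∈ S → y ≡ q ⊎ y ≡ z
  S-neighbours-of-non-member {q} {p} {z} {y} q⇝p p⇝z p∉S z∈S p~y y∈S with y ≟ q
  ... | yes y≡q = inj₁ y≡q
  ... | no  y≢q with (_ , _ , iii , _) ← edge-condition q⇝p = inj₂ (∣p∣≤1⇒≡ (≤-reflexive (iii q∈S p∉S))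
          (x∈p∧x≢y⇒x∈p-y (∈N∩⁺ T p~y y∈S) y≢q)
          (x∈p∧x≢y⇒x∈p-y (∈N∩⁺ T (Parent⇒Adj p⇝z) z∈S) z≢q))
    where
    q∈S = S-grandchild⇒S-grandparent q⇝p p⇝z p∉S z∈S
    z≢q : z ≢ q
    z≢q refl = Parent-asym p⇝z q⇝p

  module _ {F : Subset n} (F⊆S : F ⊆ S) (fortF : IsFort T F) where

    step-towards-ℓ : z ∈ S → z ≢ ℓ → ∃[ s ] (s ∈ S × depth s < depth z × (z ∈ F ⇔ s ∈ F))
    step-towards-ℓ {z} z∈S z≢ℓ with parent z ∈? S
    ... | yes p∈S = parent z , p∈S , Parent⇒depth< p⇝z , mk⇔
      (λ z∈F → fort-absorbs T fortF F⊆S (Parent⇒Adj p⇝z) z∈F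
                 (only-S-neighbour-of-parent p⇝z p∈S z∈S))
      (λ p∈F → fort-absorbs T fortF F⊆S (Adj-sym T (Parent⇒Adj p⇝z)) p∈F
                 (only-S-neighbour-of-child p⇝z p∈S z∈S))
      where
      p⇝z : Parent (parent z) z
      p⇝z = z≢ℓ , refl
    ... | no p∉S = parent (parent z) , q∈S , <-trans (Parent⇒depth< q⇝p) (Parent⇒depth< p⇝z) , mk⇔
      (fort-propagates T fortF F⊆S p∉S (Parent⇒Adj p⇝z) (λ p~y y∈S → swap (neighbours p~y y∈S)))
      (fort-propagates T fortF F⊆S p∉S (Adj-sym T (Parent⇒Adj q⇝p)) neighbours)
      where
      p⇝z : Parent (parent z) z
      p⇝z = z≢ℓ , refl
      q⇝p : Parent (parent (parent z)) (parent z)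
      q⇝p = ∉S⇒Parent p∉S
      q∈S = S-grandchild⇒S-grandparent q⇝p p⇝z p∉S z∈S
      neighbours : ∀ {y} → Adj T (parent z) y → y ∈ S → y ≡ parent (parent z) ⊎ y ≡ z
      neighbours = S-neighbours-of-non-member q⇝p p⇝z p∉S z∈S

    ∈F⇔ℓ∈F : z ∈ S → (z ∈ F ⇔ ℓ ∈ F)
    ∈F⇔ℓ∈F z∈S = go (<-wellFounded _) z∈S
      where
      go : Acc _<_ (depth z) → z ∈ S → (z ∈ F ⇔ ℓ ∈ F)
      go {z} (acc smaller) z∈S with z ≟ ℓ
      ... | yes refl = ⇔-id _
      ... | no  z≢ℓ with s , s∈S , ds<dz , z⇔s ← step-towards-ℓ z∈S z≢ℓ =
        go (smaller ds<dz) s∈S ⇔-∘ z⇔s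

  isMinimalFort : IsMinimalFort T S
  isMinimalFort = isFort , λ where
    F (F⊆S , x , x∈S , x∉F) fortF@((y , y∈F) , _) →
      x∉F (Equivalence.from (∈F⇔ℓ∈F F⊆S fortF x∈S) (Equivalence.to (∈F⇔ℓ∈F F⊆S fortF (F⊆S y∈F)) y∈F))

module Necessity {n} (T : Graph n) (connected : Connected T) (acyclic : Acyclic T)
                 (S : Subset n) (minimal : IsMinimalFort T S) where

  private
    variable
      a b c u w y : Fin n

    fortS : ∀ v → v ∉ S → ∣ N T v ∩ S ∣ ≢ 1
    fortS = proj₂ (proj₁ minimal)

  module Deepest {r : Fin n} (r∈S : r ∈ S) where

    open Rooted T connected acyclic r

    deepest : Fin n
    deepest = argmax depth r (filter (_∈? S) (allFin n))

    deepest∈S : deepest ∈ S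
    deepest∈S = argmax-all depth r∈S (All.all-filter (_∈? S) (allFin n))

    depth≤deepest : y ∈ S → depth y ≤ depth deepest
    depth≤deepest y∈S = All.lookup (f[xs]≤f[argmax] {f = depth} r (filter (_∈? S) (allFin n)))
                                   (List.∈-filter⁺ (_∈? S) (List.∈-allFin _) y∈S)

    too-deep⇒∉S : depth deepest < depth y → y ∉ S
    too-deep⇒∉S dx<dy y∈S = <⇒≱ dx<dy (depth≤deepest y∈S)

    deepest-childless : ¬ Parent deepest y
    deepest-childless {y} x⇝y =
      fortS y (too-deep⇒∉S (Parent⇒depth< x⇝y))
            (∣p∣≡1 (∈N∩⁺ T (Adj-sym T (Parent⇒Adj x⇝y)) deepest∈S) only-deepest)
      where
      only-deepest : ∀ {z} → z ∈ N T y ∩ S → z ≡ deepest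
      only-deepest z∈ with y~z , z∈S ← ∈N∩⁻ T z∈ with Adj⇒Parent y~z
      ... | inj₁ y⇝z = contradiction z∈S (too-deep⇒∉S (<-trans (Parent⇒depth< x⇝y) (Parent⇒depth< y⇝z)))
      ... | inj₂ z⇝y = Parent-unique z⇝y x⇝y

    deepest-leaf : 2 ≤ n → IsLeaf T deepest
    deepest-leaf 2≤n = ∣p∣≡1 (∈N⁺ T (Adj-sym T (Parent⇒Adj p⇝x))) only-parent
      where
      x≢r : deepest ≢ r
      x≢r x≡r with w , r⇝w ← root-has-child 2≤n = deepest-childless (subst (λ x → Parent x w) (sym x≡r) r⇝w)
      p⇝x : Parent (parent deepest) deepest
      p⇝x = x≢r , refl
      only-parent : ∀ {y} → y ∈ N T deepest → y ≡ parent deepest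
      only-parent y∈ with Adj⇒Parent (∈N⁻ T y∈)
      ... | inj₁ x⇝y = ⊥-elim (deepest-childless x⇝y)
      ... | inj₂ y⇝x = Parent-unique y⇝x p⇝x

  conditionI : 2 ≤ n → ConditionI T S
  conditionI 2≤n = deepest , deepest-leaf 2≤n , deepest∈S
    where open Deepest (proj₂ (proj₁ (proj₁ minimal)))

  module RootedAtMember {ℓ : Fin n} (ℓ∈S : ℓ ∈ S) where

    open Rooted T connected acyclic ℓ

    at-most-one-S-child : ∀ {c₁ c₂} → Parent b c₁ → Parent b c₂ → c₁ ∈ S → c₂ ∈ S → c₁ ≡ c₂
    at-most-one-S-child {b} {c₁} {c₂} b⇝c₁ b⇝c₂ c₁∈S c₂∈S with c₁ ≟ c₂
    ... | yes c₁≡c₂ = c₁≡c₂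
    ... | no  c₁≢c₂ = ⊥-elim (minimal-fort-uncuttable T minimal c₁∈S c₁∈X ℓ∈S ℓ∉X sealed outside)
      where
      X = subtree c₁ ∪ subtree c₂
      c₁∈X = x∈p∪q⁺ (inj₁ b∈subtree[b])
      c₂∈X = x∈p∪q⁺ (inj₂ b∈subtree[b])
      ∉X⇒∉ : w ∉ X → w ∉ subtree c₁ × w ∉ subtree c₂
      ∉X⇒∉ w∉X = w∉X ∘ x∈p∪q⁺ ∘ inj₁ , w∉X ∘ x∈p∪q⁺ ∘ inj₂
      ℓ∉X : ℓ ∉ X
      ℓ∉X ℓ∈X with x∈p∪q⁻ (subtree c₁) _ ℓ∈X
      ... | inj₁ ℓ∈ = r∉subtree (proj₁ b⇝c₁) ℓ∈
      ... | inj₂ ℓ∈ = r∉subtree (proj₁ b⇝c₂) ℓ∈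
      sealed : Adj T u w → u ∈ X → u ∉ S → w ∈ S → w ∉ X → ⊥
      sealed u~w u∈X u∉S _ w∉X with x∈p∪q⁻ (subtree c₁) _ u∈X
      ... | inj₁ u∈ = u∉S (subst (_∈ S) (sym (proj₁ (leave-subtree u~w u∈ (proj₁ (∉X⇒∉ w∉X))))) c₁∈S)
      ... | inj₂ u∈ = u∉S (subst (_∈ S) (sym (proj₁ (leave-subtree u~w u∈ (proj₂ (∉X⇒∉ w∉X))))) c₂∈S)
      outside : ∀ w → w ∉ X → ∣ N T w ∩ (S ∩ X) ∣ ≢ 1
      outside w w∉X with w ≟ b
      ... | yes refl = two-neighbours⇒∣N∩∣≢1 T (Parent⇒Adj b⇝c₁) (x∈p∩q⁺ (c₁∈S , c₁∈X))
                                              (Parent⇒Adj b⇝c₂) (x∈p∩q⁺ (c₂∈S , c₂∈X)) c₁≢c₂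
      ... | no  w≢b = no-neighbour⇒∣N∩∣≢1 T no-neighbour
        where
        no-neighbour : ∀ {y} → Adj T w y → y ∉ S ∩ X
        no-neighbour w~y y∈S∩X with x∈p∪q⁻ (subtree c₁) _ (proj₂ (x∈p∩q⁻ S X y∈S∩X))
        ... | inj₁ y∈ = w≢b (Parent-unique (enter-subtree w~y y∈ (proj₁ (∉X⇒∉ w∉X))) b⇝c₁)
        ... | inj₂ y∈ = w≢b (Parent-unique (enter-subtree w~y y∈ (proj₂ (∉X⇒∉ w∉X))) b⇝c₂)

    no-S-child-under-non-members : Parent a b → a ∉ S → b ∉ S → Parent b c → c ∉ S
    no-S-child-under-non-members {a} {b} {c} a⇝b a∉S b∉S b⇝c c∈S =
      minimal-fort-uncuttable T minimal ℓ∈S (x∉p⇒x∈∁p (r∉subtree (proj₁ a⇝b))) c∈S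
        (x∈p⇒x∉∁p (Parent⇒∈subtree b⇝c)) sealed outside
      where
      X = ∁ (subtree b)
      sealed : Adj T u w → u ∈ X → u ∉ S → w ∈ S → w ∉ X → ⊥
      sealed u~w u∈X _ w∈S w∉X =
        b∉S (subst (_∈ S) (proj₁ (leave-subtree (Adj-sym T u~w) (x∉∁p⇒x∈p w∉X) (x∈∁p⇒x∉p u∈X))) w∈S)
      outside : ∀ w → w ∉ X → ∣ N T w ∩ (S ∩ X) ∣ ≢ 1
      outside w w∉X = no-neighbour⇒∣N∩∣≢1 T λ w~y y∈S∩X →
        let y∈S , y∈X = x∈p∩q⁻ S X y∈S∩X
            y⇝b = proj₂ (leave-subtree w~y (x∉∁p⇒x∈p w∉X) (x∈∁p⇒x∉p y∈X))
        in a∉S (subst (_∈ S) (Parent-unique y⇝b a⇝b) y∈S)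

    no-S-child-under-members : Parent a b → a ∈ S → b ∈ S → Parent b c → c ∉ S
    no-S-child-under-members {a} {b} {c} a⇝b a∈S b∈S b⇝c c∈S =
      minimal-fort-uncuttable T minimal c∈S c∈X b∈S b∉X sealed outside
      where
      X = ∁ (subtree b) ∪ subtree c
      a∈X = x∈p∪q⁺ (inj₁ (x∉p⇒x∈∁p (Parent⇒∉subtree a⇝b)))
      c∈X = x∈p∪q⁺ (inj₂ b∈subtree[b])
      b∉X : b ∉ X
      b∉X b∈X with x∈p∪q⁻ (∁ (subtree b)) _ b∈X
      ... | inj₁ b∈∁ = x∈∁p⇒x∉p b∈∁ b∈subtree[b]
      ... | inj₂ b∈  = Parent⇒∉subtree b⇝c b∈
      ∉X⇒∈∉ : w ∉ X → w ∈ subtree b × w ∉ subtree c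
      ∉X⇒∈∉ w∉X = x∉∁p⇒x∈p (w∉X ∘ x∈p∪q⁺ ∘ inj₁) , w∉X ∘ x∈p∪q⁺ ∘ inj₂
      sealed : Adj T u w → u ∈ X → u ∉ S → w ∈ S → w ∉ X → ⊥
      sealed u~w u∈X u∉S _ w∉X with ∉X⇒∈∉ w∉X | x∈p∪q⁻ (∁ (subtree b)) _ u∈X
      ... | w∈b , _   | inj₁ u∈∁ =
        u∉S (subst (_∈ S) (sym (Parent-unique (enter-subtree u~w w∈b (x∈∁p⇒x∉p u∈∁)) a⇝b)) a∈S)
      ... | _ , w∉c | inj₂ u∈c = u∉S (subst (_∈ S) (sym (proj₁ (leave-subtree u~w u∈c w∉c))) c∈S)
      outside : ∀ w → w ∉ X → ∣ N T w ∩ (S ∩ X) ∣ ≢ 1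
      outside w w∉X with w ≟ b
      ... | yes refl = two-neighbours⇒∣N∩∣≢1 T (Adj-sym T (Parent⇒Adj a⇝b)) (x∈p∩q⁺ (a∈S , a∈X))
                         (Parent⇒Adj b⇝c) (x∈p∩q⁺ (c∈S , c∈X)) λ { refl → Parent-asym a⇝b b⇝c }
      ... | no  w≢b = no-neighbour⇒∣N∩∣≢1 T no-neighbour
        where
        no-neighbour : ∀ {y} → Adj T w y → y ∉ S ∩ X
        no-neighbour w~y y∈S∩X with ∉X⇒∈∉ w∉X | x∈p∪q⁻ (∁ (subtree b)) _ (proj₂ (x∈p∩q⁻ S X y∈S∩X))
        ... | w∈b , _   | inj₁ y∈∁ = w≢b (proj₁ (leave-subtree w~y w∈b (x∈∁p⇒x∉p y∈∁)))
        ... | _ , w∉c | inj₂ y∈c = w≢b (Parent-unique (enter-subtree w~y y∈c w∉c) b⇝c)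

    edge-condition : Parent a b → EdgeCondition T S a b
    edge-condition {a} {b} a⇝b = i , ii , iii , iv
      where
      S-child : c ∈ (N T b ∩ S) - a → Parent b c × c ∈ S
      S-child c∈ with c∈′ , c≢a ← x∈p-y⁻ (N T b ∩ S) c∈ with b~c , c∈S ← ∈N∩⁻ T c∈′ =
        other-neighbour⇒Parent a⇝b b~c c≢a , c∈S
      at-most-one-besides-a : ∀ {c d} → c ∈ (N T b ∩ S) - a → d ∈ (N T b ∩ S) - a → c ≡ d
      at-most-one-besides-a c∈ d∈ with b⇝c , c∈S ← S-child c∈ with b⇝d , d∈S ← S-child d∈ =
        at-most-one-S-child b⇝c b⇝d c∈S d∈S
      besides-a : a ∉ S → c ∈ N T b ∩ S → c ∈ (N T b ∩ S) - a
      besides-a a∉S c∈ = x∈p∧x≢y⇒x∈p-y c∈ λ { refl → a∉S (proj₂ (∈N∩⁻ T c∈)) }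

      i : a ∉ S → b ∉ S → ∣ N T b ∩ S ∣ ≡ 0
      i a∉S b∉S = x∉p⇒∣p∣≡0 λ _ c∈ → let b⇝c , c∈S = S-child (besides-a a∉S c∈) in
        no-S-child-under-non-members a⇝b a∉S b∉S b⇝c c∈S
      ii : a ∉ S → b ∈ S → ∣ N T b ∩ S ∣ ≤ 1
      ii a∉S _ = ≡⇒∣p∣≤1 λ c∈ d∈ → at-most-one-besides-a (besides-a a∉S c∈) (besides-a a∉S d∈)
      iii : a ∈ S → b ∉ S → ∣ (N T b ∩ S) - a ∣ ≡ 1
      iii a∈S b∉S with c , c∈ , c≢a ← ∣p∣≢1⇒another (∈N∩⁺ T (Adj-sym T (Parent⇒Adj a⇝b)) a∈S) (fortS b b∉S) =
        ≤-antisym (≡⇒∣p∣≤1 at-most-one-besides-a) (x∈p⇒1≤∣p∣ (x∈p∧x≢y⇒x∈p-y c∈ c≢a))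
      iv : a ∈ S → b ∈ S → ∣ (N T b ∩ S) - a ∣ ≡ 0
      iv a∈S b∈S = x∉p⇒∣p∣≡0 λ _ c∈ → let b⇝c , c∈S = S-child c∈ in
        no-S-child-under-members a⇝b a∈S b∈S b⇝c c∈S

  conditionII : ConditionII T S
  conditionII ℓ _ ℓ∈S a b a~b a-closer = edge-condition (Closer⇒Parent a~b a-closer)
    where
    open Rooted T connected acyclic ℓ using (Closer⇒Parent)
    open RootedAtMember ℓ∈S

lemma12 : ∀ (n : ℕ) (T : Graph n) → IsTree T → 3 ≤ n → (S : Subset n) →
    IsMinimalFort T S ⇔ (ConditionI T S × ConditionII T S)
lemma12 n T (connected , acyclic) 3≤n S = mk⇔
  (λ minimal → let open Necessity T connected acyclic S minimal in conditionI (<⇒≤ 3≤n) , conditionII)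
  (λ ((_ , ℓ-leaf , ℓ∈S) , edge-conditions) →
     Sufficiency.isMinimalFort T connected acyclic S ℓ-leaf ℓ∈S edge-conditions)
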